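{- Let $U$ be an it-complete and it-tame set of time-constructible bounds such that $2n\le_a\beta(n)$ for all $\beta\in U$. Then the map $\varphi$ given by $\varphi([B])=\mathrm{Cl}_U(B)$ for regular $B\subseteq U$ is a well-defined order-isomorphism between $(\overline{\mathrm{Reg}(U)},\le)$ and $(\mathrm{Cl}_{\mathrm{it}}(U),\subseteq)$.
   Context: A (time) bound is $\beta:\mathbb{N}\to\mathbb{N}$ with $n\le\beta(n)\le\beta(n+1)$. $f\le_a g$: $f(n)\le g(n)$ for almost all $n$; for sets, $B_1\le_a B_2$: each element of $B_1$ is $\le_a$ some element of $B_2$. Time-constructible: $w\mapsto1^{\beta(|w|)}$ computable by a deterministic multitape TM with output tape in time $O(\beta(|w|))$. A nonempty set $B$ is regular if (i) every $\beta\in B$ has a time-constructible $\beta'\in B$ with $\beta\le_a\beta'$, and (ii) for all $\beta,\beta'\in B$ there is $\beta''\in B$ with $\beta+\beta'\circ\beta\le_a\beta''$. $\mathrm{Reg}(U)$ is the set of regular subsets of $U$; $B_1\equiv B_2$ iff $B_1\le_a B_2$ and $B_2\le_a B_1$; $\overline{\mathrm{Reg}(U)}$ is the set of $\equiv$-classes $[B]$ of elements of $\mathrm{Reg}(U)$, ordered by $[B_1]\le[B_2]$ iff $B_1\le_a B_2$. $\mathrm{It}(\beta)=\{\beta^{\langle m\rangle}:m\ge1\}$; $\beta_1\le_{\mathrm{it}}\beta_2$ iff $\mathrm{It}(\beta_1)\le_a\mathrm{It}(\beta_2)$. $U$ is it-tame if any two elements are $\le_{\mathrm{it}}$-comparable;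 $U$ is it-complete if for every $\beta\in U$ there is $B\subseteq U$ with $B\le_a\mathrm{It}(\beta)$ and $\mathrm{It}(\beta)\le_a B$. $\mathrm{Cl}_U(B)=\{\beta\in U:\exists\beta'\in B,\ \beta\le_{\mathrm{it}}\beta'\}$. $\mathrm{Cl}_{\mathrm{it}}(U)$ is the set of nonempty $B\subseteq U$ closed under $\le_{\mathrm{it}}$ (i.e. $\beta\in U$, $\beta\le_{\mathrm{it}}\beta'\in B$ implies $\beta\in B$). -}

module Defs where

open import Data.Nat using (ℕ; zero; suc; _+_; _*_; _≤_)
open import Data.Product using (Σ; ∃; _×_; _,_)
open import Data.Sum using (_⊎_)
open import Function using (id; _∘_)
open import Relation.Binary.PropositionalEquality using (_≡_)

Fun : Set
Fun = ℕ → ℕ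

FunSet : Set₁
FunSet = Fun → Set

IsBound : Fun → Set
IsBound β = (n : ℕ) → (n ≤ β n) × (β n ≤ β (suc n))

_≤a_ : Fun → Fun → Set
f ≤a g = Σ ℕ λ N → (n : ℕ) → N ≤ n → f n ≤ g n

_≤A_ : FunSet → FunSet → Set
B₁ ≤A B₂ = (f : Fun) → B₁ f → Σ Fun λ g → B₂ g × (f ≤a g)

_⊆_ : FunSet → FunSet → Set
A ⊆ B = (f : Fun) → A f → B f

_≐_ : FunSet → FunSet → Set
A ≐ B = (A ⊆ B) × (B ⊆ A)

Nonempty : FunSet → Set
Nonempty B = Σ Fun λ f → B f

iter : ℕ → Fun → Fun
iter zero    β = id
iter (suc m) β = β ∘ iter m β

-- It(β) = { β^⟨m⟩ : m ≥ 1 }  (membership up to pointwise equality)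
It : Fun → FunSet
It β f = Σ ℕ λ m → (n : ℕ) → f n ≡ iter (suc m) β n

_≤it_ : Fun → Fun → Set
β₁ ≤it β₂ = It β₁ ≤A It β₂

ItTame : FunSet → Set
ItTame U = (β β' : Fun) → U β → U β' → (β ≤it β') ⊎ (β' ≤it β)

ItComplete : FunSet → Set₁
ItComplete U = (β : Fun) → U β →
  Σ FunSet λ B → (B ⊆ U) × (B ≤A It β) × (It β ≤A B)

-- Regularity, relative to a predicate TC ("time-constructible").
Regular : (TC : FunSet) → FunSet → Set
Regular TC B =
  Nonempty B
  × ((β : Fun) → B β → Σ Fun λ β' → B β' × TC β' × (β ≤a β'))
  × ((β β' : Fun) → B β → B β' →
       Σ Fun λ β'' → B β'' × ((λ n → β n + β' (β n)) ≤a β''))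

Reg : (TC U : FunSet) → FunSet → Set
Reg TC U B = (B ⊆ U) × Regular TC B

Cl : FunSet → FunSet → FunSet
Cl U B β = U β × (Σ Fun λ β' → B β' × (β ≤it β'))

ClIt : FunSet → FunSet → Set
ClIt U B = Nonempty B × (B ⊆ U) ×
  ((β β' : Fun) → U β → B β' → β ≤it β' → B β)

-- A regular set B is ≤a-equivalent to the union of It(β) over its elements β, because B
-- is closed under β, β' ↦ β + β' ∘ β and this dominates β' ∘ β; hence [B] is determined
-- by the ≤it-downward closure of B, which is Cl_U(B). Conversely, an ≤it-closed C is
-- Cl_U of the union of the sets B_β that it-completeness attaches to each β ∈ C; this
-- union is regular because it-tameness puts any two of its elements below iterates of
-- a single h ∈ C, and 2n ≤a h absorbs the sum into one more iteration of h.
module Submission where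

open import Defs
open import Data.Nat using (ℕ; zero; suc; _+_; _*_; _≤_; _≤′_; ≤′-refl; ≤′-step)
open import Data.Nat.Properties
  using (≤-refl; ≤-reflexive; ≤-trans; ≤⇒≤′; +-mono-≤; +-identityʳ; m≤n+m;
         m+n≤o⇒m≤o; m+n≤o⇒n≤o)
open import Data.Product using (Σ; _×_; _,_; proj₁; proj₂)
open import Data.Sum using (inj₁; inj₂)
open import Function using (_∘_)
open import Function.Bundles using (_⇔_; mk⇔)
open import Relation.Binary.Definitions using (Monotonic₁)
open import Relation.Binary.PropositionalEquality using (_≡_; refl; sym; trans; cong)

Monotone : Fun → Set
Monotone = Monotonic₁ _≤_ _≤_

Inflationary : Fun → Set
Inflationary f = (n : ℕ) → n ≤ f n

_⊕_ : Fun → Fun → Fun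
(f ⊕ f') n = f n + f' (f n)

_≼_ : Fun → FunSet → Set
f ≼ A = Σ Fun λ g → A g × (f ≤a g)

⊕-Closed : FunSet → Set
⊕-Closed B = (β β' : Fun) → B β → B β' → (β ⊕ β') ≼ B

bound-monotone : {β : Fun} → IsBound β → Monotone β
bound-monotone {β} bound m≤n = go (≤⇒≤′ m≤n)
  where
  go : {m n : ℕ} → m ≤′ n → β m ≤ β n
  go ≤′-refl      = ≤-refl
  go (≤′-step m≤n) = ≤-trans (go m≤n) (proj₂ (bound _))

bound-inflationary : {β : Fun} → IsBound β → Inflationary β
bound-inflationary bound n = proj₁ (bound n)

≤a-refl : {f : Fun} → f ≤a f
≤a-refl = 0 , λ n _ → ≤-refl

≤a-reflexive : {f g : Fun} → ((n : ℕ) → f n ≡ g n) → f ≤a g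
≤a-reflexive f≡g = 0 , λ n _ → ≤-reflexive (f≡g n)

≤a-trans : {f g h : Fun} → f ≤a g → g ≤a h → f ≤a h
≤a-trans (N , f≤g) (M , g≤h) =
  N + M , λ n N+M≤n → ≤-trans (f≤g n (m+n≤o⇒m≤o N N+M≤n)) (g≤h n (m+n≤o⇒n≤o N N+M≤n))

≤a-≼-trans : {f g : Fun} {A : FunSet} → f ≤a g → g ≼ A → f ≼ A
≤a-≼-trans f≤g (h , Ah , g≤h) = h , Ah , ≤a-trans f≤g g≤h

≼-⊆ : {f : Fun} {A B : FunSet} → f ≼ A → A ⊆ B → f ≼ B
≼-⊆ (g , Ag , f≤g) A⊆B = g , A⊆B g Ag , f≤g

≼-trans : {f : Fun} {A B : FunSet} → f ≼ A → A ≤A B → f ≼ B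
≼-trans (g , Ag , f≤g) A≤B = ≤a-≼-trans f≤g (A≤B g Ag)

≤A-trans : {A B C : FunSet} → A ≤A B → B ≤A C → A ≤A C
≤A-trans A≤B B≤C f Af = ≼-trans (A≤B f Af) B≤C

iter-inflationary : {f : Fun} → Inflationary f → (k : ℕ) → Inflationary (iter k f)
iter-inflationary infl zero    n = ≤-refl
iter-inflationary {f} infl (suc k) n = ≤-trans (iter-inflationary infl k n) (infl (iter k f n))

iter-+ : (f : Fun) (a b n : ℕ) → iter (a + b) f n ≡ iter a f (iter b f n)
iter-+ f zero    b n = refl
iter-+ f (suc a) b n = cong f (iter-+ f a b n)

iter-* : (f : Fun) (a b n : ℕ) → iter a (iter b f) n ≡ iter (a * b) f n
iter-* f zero    b n = refl
iter-* f (suc a) b n = trans (cong (iter b f) (iter-* f a b n)) (sym (iter-+ f b (a * b) n))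

It-self : {f : Fun} → It f f
It-self = 0 , λ n → refl

It-iter : (f : Fun) (m : ℕ) → It f (iter (suc m) f)
It-iter f m = m , λ n → refl

iter-mono-≤a : {f g : Fun} → Monotone f → Inflationary g → f ≤a g →
  (k : ℕ) → iter k f ≤a iter k g
iter-mono-≤a {f} {g} monoF inflG (N , f≤g) k = N , go k
  where
  go : (k n : ℕ) → N ≤ n → iter k f n ≤ iter k g n
  go zero    n N≤n = ≤-refl
  go (suc k) n N≤n =
    ≤-trans (monoF (go k n N≤n)) (f≤g _ (≤-trans N≤n (iter-inflationary inflG k n)))

≤it-refl : (f : Fun) → f ≤it f
≤it-refl f g Itg = g , Itg , ≤a-refl

≤it-trans : (f g h : Fun) → f ≤it g → g ≤it h → f ≤it h
≤it-trans f g h = ≤A-trans {It f} {It g} {It h}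

≤a⇒≤it : {f g : Fun} → Monotone f → Inflationary g → f ≤a g → f ≤it g
≤a⇒≤it {g = g} monoF inflG f≤g h (m , h≡) =
  iter (suc m) g , It-iter g m , ≤a-trans (≤a-reflexive h≡) (iter-mono-≤a monoF inflG f≤g (suc m))

iter-≤it : (f : Fun) (m : ℕ) → iter (suc m) f ≤it f
iter-≤it f m h (j , h≡) =
  iter (suc (m + j * suc m)) f , It-iter f (m + j * suc m) ,
  ≤a-reflexive (λ n → trans (h≡ n) (iter-* f (suc j) (suc m) n))

≼It⇒≤it : {f h : Fun} → Monotone f → Inflationary h → f ≼ It h → f ≤it h
≼It⇒≤it {f} {h} monoF inflH (g , (m , g≡) , f≤g) =
  ≤it-trans f (iter (suc m) h) h
    (≤a⇒≤it monoF (iter-inflationary inflH (suc m)) (≤a-trans f≤g (≤a-reflexive g≡)))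
    (iter-≤it h m)

∘-≤a-⊕ : {f g β : Fun} → Monotone β → f ≤a g → (β ∘ f) ≤a (g ⊕ β)
∘-≤a-⊕ {g = g} {β} monoβ (N , f≤g) =
  N , λ n N≤n → ≤-trans (monoβ (f≤g n N≤n)) (m≤n+m (β (g n)) (g n))

⊕-mono-≤a : {f f' g g' : Fun} → Monotone f' → Inflationary g →
  f ≤a g → f' ≤a g' → (f ⊕ f') ≤a (g ⊕ g')
⊕-mono-≤a {g = g} monoF' inflG (N , f≤g) (M , f'≤g') =
  N + M , λ n N+M≤n →
    let fn≤gn = f≤g n (m+n≤o⇒m≤o N N+M≤n)
    in +-mono-≤ fn≤gn
         (≤-trans (monoF' fn≤gn) (f'≤g' (g n) (≤-trans (m+n≤o⇒n≤o N N+M≤n) (inflG n))))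

-- Both summands are at most y = iter (k₂ + k₁) h n, and 2 * y ≤ h y.
iter-⊕-≤a : {h : Fun} → Inflationary h → (λ n → 2 * n) ≤a h →
  (k₁ k₂ : ℕ) → (iter k₁ h ⊕ iter k₂ h) ≤a iter (suc (k₂ + k₁)) h
iter-⊕-≤a {h} inflH (N , double≤h) k₁ k₂ =
  N , λ n N≤n →
    let y = iter (k₂ + k₁) h n
        y≡ = iter-+ h k₂ k₁ n
    in ≤-trans (+-mono-≤ (≤-trans (iter-inflationary inflH k₂ _) (≤-reflexive (sym y≡)))
                         (≤-reflexive (sym y≡)))
         (≤-trans (≤-reflexive (cong (y +_) (sym (+-identityʳ y))))
                  (double≤h y (≤-trans N≤n (iter-inflationary inflH (k₂ + k₁) n))))

⊕-≼-It : {f f' h : Fun} → Monotone f' → Inflationary h → (λ n → 2 * n) ≤a h →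
  f ≼ It h → f' ≼ It h → (f ⊕ f') ≼ It h
⊕-≼-It {h = h} monoF' inflH double≤h (g , (k₁ , g≡) , f≤g) (g' , (k₂ , g'≡) , f'≤g') =
  iter (suc (suc k₂ + suc k₁)) h , It-iter h (suc k₂ + suc k₁) ,
  ≤a-trans (⊕-mono-≤a monoF' (iter-inflationary inflH (suc k₁))
                      (≤a-trans f≤g (≤a-reflexive g≡)) (≤a-trans f'≤g' (≤a-reflexive g'≡)))
           (iter-⊕-≤a inflH double≤h (suc k₁) (suc k₂))

module Closure (U : FunSet) (bound : (β : Fun) → U β → IsBound β) where

  private
    monoU : {β : Fun} → U β → Monotone β
    monoU Uβ = bound-monotone (bound _ Uβ)

    inflU : {β : Fun} → U β → Inflationary β
    inflU Uβ = bound-inflationary (bound _ Uβ)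

  It≤A-⊕-closed : {B : FunSet} → B ⊆ U → ⊕-Closed B → {β : Fun} → B β → It β ≤A B
  It≤A-⊕-closed {B} B⊆U closed {β} Bβ g (m , g≡) = ≤a-≼-trans (≤a-reflexive g≡) (iter-≼ m)
    where
    iter-≼ : (k : ℕ) → iter (suc k) β ≼ B
    iter-≼ zero = β , Bβ , ≤a-refl
    iter-≼ (suc k) with iter-≼ k
    ... | g , Bg , βᵏ≤g =
      ≤a-≼-trans (∘-≤a-⊕ (monoU (B⊆U β Bβ)) βᵏ≤g) (closed g β Bg Bβ)

  Cl-mono : {B₁ B₂ : FunSet} → B₁ ⊆ U → B₂ ⊆ U → B₁ ≤A B₂ → Cl U B₁ ⊆ Cl U B₂
  Cl-mono B₁⊆U B₂⊆U B₁≤B₂ β (Uβ , β' , B₁β' , β≤β') with B₁≤B₂ β' B₁β'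
  ... | β'' , B₂β'' , β'≤β'' =
    Uβ , β'' , B₂β'' ,
    ≤it-trans β β' β'' β≤β' (≤a⇒≤it (monoU (B₁⊆U β' B₁β')) (inflU (B₂⊆U β'' B₂β'')) β'≤β'')

  Cl-ClIt : {B : FunSet} → B ⊆ U → Nonempty B → ClIt U (Cl U B)
  Cl-ClIt B⊆U (β , Bβ) =
    (β , B⊆U β Bβ , β , Bβ , ≤it-refl β) ,
    (λ γ → proj₁) ,
    λ γ γ' Uγ (_ , δ , Bδ , γ'≤δ) γ≤γ' → Uγ , δ , Bδ , ≤it-trans γ γ' δ γ≤γ' γ'≤δ

  Cl-reflects : {B₁ B₂ : FunSet} → B₁ ⊆ U → B₂ ⊆ U → ⊕-Closed B₂ →
    Cl U B₁ ⊆ Cl U B₂ → B₁ ≤A B₂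
  Cl-reflects B₁⊆U B₂⊆U closed Cl₁⊆Cl₂ β B₁β
    with Cl₁⊆Cl₂ β (B₁⊆U β B₁β , β , B₁β , ≤it-refl β)
  ... | _ , β' , B₂β' , β≤β' = ≼-trans (β≤β' β It-self) (It≤A-⊕-closed B₂⊆U closed B₂β')

  module Onto (TC : FunSet) (tc : (β : Fun) → U β → TC β)
              (doubling : (β : Fun) → U β → (λ n → 2 * n) ≤a β)
              (complete : ItComplete U) (tame : ItTame U) where

    Cl-onto : (C : FunSet) → ClIt U C → Σ FunSet λ B → Reg TC U B × (Cl U B ≐ C)
    Cl-onto C ((β₀ , Cβ₀) , C⊆U , C-closed) =
      B , (B⊆U , nonempty , (λ f Bf → f , Bf , tc f (B⊆U f Bf) , ≤a-refl) , ⊕-closed) ,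
      Cl⊆C , C⊆Cl
      where
      basis : {β : Fun} → C β → FunSet
      basis Cβ = proj₁ (complete _ (C⊆U _ Cβ))

      basis⊆U : {β : Fun} (Cβ : C β) → basis Cβ ⊆ U
      basis⊆U Cβ = proj₁ (proj₂ (complete _ (C⊆U _ Cβ)))

      basis≤It : {β : Fun} (Cβ : C β) → basis Cβ ≤A It β
      basis≤It Cβ = proj₁ (proj₂ (proj₂ (complete _ (C⊆U _ Cβ))))

      It≤basis : {β : Fun} (Cβ : C β) → It β ≤A basis Cβ
      It≤basis Cβ = proj₂ (proj₂ (proj₂ (complete _ (C⊆U _ Cβ))))

      B : FunSet
      B f = Σ Fun λ β → Σ (C β) λ Cβ → basis Cβ f

      basis⊆B : {β : Fun} (Cβ : C β) → basis Cβ ⊆ B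
      basis⊆B Cβ f x = _ , Cβ , x

      B⊆U : B ⊆ U
      B⊆U f (β , Cβ , x) = basis⊆U Cβ f x

      nonempty : Nonempty B
      nonempty = let (f , x , _) = It≤basis Cβ₀ β₀ It-self in f , basis⊆B Cβ₀ f x

      ⊕-≼B : {f f' h : Fun} → B f' → C h → f ≼ It h → f' ≼ It h → (f ⊕ f') ≼ B
      ⊕-≼B {f' = f'} {h} Bf' Ch f≼ f'≼ =
        let Uh = C⊆U h Ch
        in ≼-⊆ (≼-trans (⊕-≼-It (monoU (B⊆U f' Bf')) (inflU Uh) (doubling h Uh) f≼ f'≼)
                        (It≤basis Ch))
               (basis⊆B Ch)

      ⊕-closed : ⊕-Closed B
      ⊕-closed f f' (β , Cβ , x) Bf'@(β' , Cβ' , x') with tame β β' (C⊆U β Cβ) (C⊆U β' Cβ')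
      ... | inj₁ β≤β' = ⊕-≼B Bf' Cβ' (≼-trans (basis≤It Cβ f x) β≤β') (basis≤It Cβ' f' x')
      ... | inj₂ β'≤β = ⊕-≼B Bf' Cβ (basis≤It Cβ f x) (≼-trans (basis≤It Cβ' f' x') β'≤β)

      Cl⊆C : Cl U B ⊆ C
      Cl⊆C γ (Uγ , f , (β , Cβ , x) , γ≤f) =
        C-closed γ β Uγ Cβ
          (≤it-trans γ f β γ≤f
            (≼It⇒≤it (monoU (basis⊆U Cβ f x)) (inflU (C⊆U β Cβ)) (basis≤It Cβ f x)))

      C⊆Cl : C ⊆ Cl U B
      C⊆Cl β Cβ =
        let (f , x , β≤f) = It≤basis Cβ β It-self
        in C⊆U β Cβ , f , basis⊆B Cβ f x ,
           ≤a⇒≤it (monoU (C⊆U β Cβ)) (inflU (basis⊆U Cβ f x)) β≤f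

proposition4 : (TC U : FunSet) →
    ((β : Fun) → U β → IsBound β × TC β × ((λ n → 2 * n) ≤a β)) →
    ItComplete U → ItTame U →
    ((B₁ B₂ : FunSet) → Reg TC U B₁ → Reg TC U B₂ →
       B₁ ≤A B₂ → B₂ ≤A B₁ → Cl U B₁ ≐ Cl U B₂)
    × ((B : FunSet) → Reg TC U B → ClIt U (Cl U B))
    × ((B₁ B₂ : FunSet) → Reg TC U B₁ → Reg TC U B₂ →
       (B₁ ≤A B₂) ⇔ (Cl U B₁ ⊆ Cl U B₂))
    × ((C : FunSet) → ClIt U C →
       Σ FunSet λ B → Reg TC U B × (Cl U B ≐ C))
proposition4 TC U hyp complete tame =
    (λ B₁ B₂ (B₁⊆U , _) (B₂⊆U , _) B₁≤B₂ B₂≤B₁ →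
       Cl-mono B₁⊆U B₂⊆U B₁≤B₂ , Cl-mono B₂⊆U B₁⊆U B₂≤B₁)
  , (λ B (B⊆U , nonempty , _) → Cl-ClIt B⊆U nonempty)
  , (λ B₁ B₂ (B₁⊆U , _) (B₂⊆U , _ , _ , closed₂) →
       mk⇔ (Cl-mono B₁⊆U B₂⊆U) (Cl-reflects B₁⊆U B₂⊆U closed₂))
  , Cl-onto
  where
  open Closure U (λ β Uβ → proj₁ (hyp β Uβ))
  open Onto TC (λ β Uβ → proj₁ (proj₂ (hyp β Uβ))) (λ β Uβ → proj₂ (proj₂ (hyp β Uβ)))
            complete tame
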